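{- Let $a$ be a positive integer such that $a+1$ is a prime congruent to $2$ or $3 \pmod 5$. Then there are no positive integers $b,c$ with $a<b$, $c-b=4$ and $a!\,b!=c!$.
   Context: A solution of $a!\,b!=c!$ in integers with $a<b$ is called a class $k$ solution if $c-b=k$; the claim says there are no class $4$ solutions in positive integers with $a+1$ such a prime. -}

module Defs where

{-# OPTIONS --safe #-}
-- If a! b! = (b + 4)! then a! = (b+1)(b+2)(b+3)(b+4), and this product plus one is the square of
-- q = b² + 5b + 5. For p = a + 1 prime, Wilson's theorem gives p ∣ a! + 1 = q², hence p ∣ q and
-- (2b + 5)² = 4q + 5 ≡ 5 (mod p); here p ≠ 2, as a! = (b+1)⋯(b+4) > 1. But 5 is a quadratic
-- non-residue modulo an odd prime p ≡ ±2 (mod 5): by Gauss's lemma 5^((p-1)/2) ≡ (-1)^μ, where μ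
-- counts the k ≤ (p-1)/2 whose multiple 5k has residue above (p-1)/2, and sorting these k by
-- ⌊5k/p⌋ into five blocks shows that μ is odd, whereas a square z² ≡ 5 would give
-- 5^((p-1)/2) ≡ z^(p-1) ≡ 1.
module Submission where

open import Defs

open import Algebra.Bundles using (CommutativeMonoid)
open import Data.List using (List; []; _∷_; length; applyDownFrom)
open import Data.List.Properties using (length-applyDownFrom)
open import Data.List.Membership.Propositional using (_∈_)
open import Data.List.Membership.Propositional.Properties using (∈-∃++; ∈-applyDownFrom⁺; ∈-applyDownFrom⁻)
open import Data.List.Relation.Unary.Any using (here; there)
open import Data.List.Relation.Unary.All as All using ()
open import Data.List.Relation.Unary.AllPairs using (_∷_)
open import Data.List.Relation.Unary.Unique.Propositional using (Unique)
open import Data.List.Relation.Unary.Unique.Propositional.Properties using (applyDownFrom⁺₁)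
open import Data.List.Relation.Binary.Subset.Propositional using (_⊆_)
open import Data.List.Relation.Binary.Permutation.Propositional using (_↭_; ↭-refl; ↭-sym; ↭-trans; ↭-prep; ↭⇒↭ₛ)
open import Data.List.Relation.Binary.Permutation.Propositional.Properties using (∈-resp-↭; ↭-length; shift)
open import Data.List.Relation.Binary.Permutation.Setoid.Properties using (foldr-commMonoid; Unique-resp-↭)
open import Data.Nat using (ℕ; zero; suc; _+_; _*_; _∸_; _^_; _/_; _≤_; _<_; _≤?_; _!; _%_; z≤n; s≤s; s≤s⁻¹; z<s; NonZero; >-nonZero; nonTrivial⇒n>1)
open import Data.Nat.Properties
open import Algebra.Properties.CommutativeSemigroup *-commutativeSemigroup using () renaming (interchange to *-interchange)
open import Data.Nat.DivMod using (m≡m%n+[m/n]*n; m%n%n≡m%n; %-distribˡ-+; %-distribˡ-*; %-remove-+ʳ; m<n⇒m%n≡m; m*n%n≡0; m%n<n; [m+kn]%n≡m%n; m*n≤o⇒[o∸m*n]%n≡o%n)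
open import Data.Nat.Divisibility using (_∣_; ∣-refl; divides; _∣0; n∣m⇒m%n≡0; m%n≡0⇒n∣m; ∣⇒≤; >⇒∤; ∣m⇒∣m*n; ∣n⇒∣m*n; ∣1⇒≡1)
open import Data.Nat.ListAction using (product)
open import Data.Nat.Primality using (Prime; prime?; euclidsLemma; prime⇒irreducible; prime⇒nonZero; prime⇒nonTrivial)
open import Data.Nat.Tactic.RingSolver using (solve; solve-∀)
open import Data.Product using (∃; ∃₂; _×_; _,_; proj₁; proj₂)
open import Data.Sum using (_⊎_; inj₁; inj₂; [_,_]′)
open import Function using (_∘_; id)
open import Relation.Nullary using (¬_; contradiction; yes; no)
open import Relation.Nullary.Decidable using (toWitness)
open import Relation.Binary.PropositionalEquality using (_≡_; _≢_; refl; sym; trans; cong; cong₂; subst; module ≡-Reasoning)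
open import Relation.Binary.PropositionalEquality.Properties using (setoid)

private
  variable
    A : Set
    x y : A
    xs ys : List A

∈⇒↭∷ : x ∈ ys → ∃ λ zs → ys ↭ x ∷ zs
∈⇒↭∷ {x = x} x∈ys with us , vs , refl ← ∈-∃++ x∈ys = _ , shift x us vs

∈-∷-≢ : x ∈ y ∷ ys → x ≢ y → x ∈ ys
∈-∷-≢ (here x≡y)   x≢y = contradiction x≡y x≢y
∈-∷-≢ (there x∈ys) _   = x∈ys

unique-⊆⇒↭ : Unique xs → xs ⊆ ys → length ys ≤ length xs → xs ↭ ys
unique-⊆⇒↭ {xs = []}     {ys = []} _ _ _ = ↭-refl
unique-⊆⇒↭ {xs = x ∷ xs} (x∉xs ∷ xs-unique) x∷xs⊆ys |ys|≤
  with zs , ys↭x∷zs ← ∈⇒↭∷ (x∷xs⊆ys (here refl)) =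
  ↭-trans (↭-prep x (unique-⊆⇒↭ xs-unique xs⊆zs |zs|≤)) (↭-sym ys↭x∷zs)
  where
  xs⊆zs : xs ⊆ zs
  xs⊆zs w∈xs = ∈-∷-≢ (∈-resp-↭ ys↭x∷zs (x∷xs⊆ys (there w∈xs))) (All.lookup x∉xs w∈xs ∘ sym)
  |zs|≤ : length zs ≤ length xs
  |zs|≤ = s≤s⁻¹ (subst (_≤ suc (length xs)) (↭-length ys↭x∷zs) |ys|≤)

product-↭ : {ms ns : List ℕ} → ms ↭ ns → product ms ≡ product ns
product-↭ σ = foldr-commMonoid ℕ*.setoid ℕ*.isCommutativeMonoid (↭⇒↭ₛ σ)
  where module ℕ* = CommutativeMonoid *-1-commutativeMonoid

∏ : ℕ → (ℕ → ℕ) → ℕ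
∏ zero    f = 1
∏ (suc n) f = f (suc n) * ∏ n f

∏≡product : ∀ n f → ∏ n f ≡ product (applyDownFrom (f ∘ suc) n)
∏≡product zero    f = refl
∏≡product (suc n) f = cong (f (suc n) *_) (∏≡product n f)

∏-cong : ∀ n {f g} → (∀ {k} → 0 < k → k ≤ n → f k ≡ g k) → ∏ n f ≡ ∏ n g
∏-cong zero    _   = refl
∏-cong (suc n) f≡g = cong₂ _*_ (f≡g z<s ≤-refl) (∏-cong n (λ 0<k k≤n → f≡g 0<k (m≤n⇒m≤1+n k≤n)))

∏-* : ∀ n f g → ∏ n (λ k → f k * g k) ≡ ∏ n f * ∏ n g
∏-* zero    f g = refl
∏-* (suc n) f g = trans (cong (f (suc n) * g (suc n) *_) (∏-* n f g))
                        (*-interchange (f (suc n)) (g (suc n)) (∏ n f) (∏ n g))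

∏-id : ∀ n → ∏ n id ≡ n !
∏-id zero    = refl
∏-id (suc n) = cong (suc n *_) (∏-id n)

∏-const : ∀ n c → ∏ n (λ _ → c) ≡ c ^ n
∏-const zero    c = refl
∏-const (suc n) c = cong (c *_) (∏-const n c)

∏-+ : ∀ m n f → ∏ (m + n) f ≡ ∏ n (λ i → f (m + i)) * ∏ m f
∏-+ m zero    f = trans (cong (λ k → ∏ k f) (+-identityʳ m)) (sym (*-identityˡ (∏ m f)))
∏-+ m (suc n) f = begin
  ∏ (m + suc n) f                                    ≡⟨ cong (λ k → ∏ k f) (+-suc m n) ⟩
  f (suc (m + n)) * ∏ (m + n) f                      ≡⟨ cong₂ _*_ (cong f (sym (+-suc m n))) (∏-+ m n f) ⟩
  f (m + suc n) * (∏ n (λ i → f (m + i)) * ∏ m f)   ≡⟨ *-assoc (f (m + suc n)) _ _ ⟨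
  f (m + suc n) * ∏ n (λ i → f (m + i)) * ∏ m f     ∎
  where open ≡-Reasoning

∏-permutation : ∀ n f →
  (∀ {k} → 0 < k → k ≤ n → 0 < f k × f k ≤ n) →
  (∀ {j k} → 0 < j → j ≤ n → 0 < k → k ≤ n → f j ≡ f k → j ≡ k) →
  ∏ n f ≡ n !
∏-permutation n f maps-into injective = begin
  ∏ n f                                  ≡⟨ ∏≡product n f ⟩
  product (applyDownFrom (f ∘ suc) n)    ≡⟨ product-↭ (unique-⊆⇒↭ image-unique image⊆ |range|≤) ⟩
  product (applyDownFrom suc n)          ≡⟨ ∏≡product n id ⟨
  ∏ n id                                 ≡⟨ ∏-id n ⟩
  n !                                    ∎
  where
  open ≡-Reasoning
  image-unique : Unique (applyDownFrom (f ∘ suc) n)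
  image-unique = applyDownFrom⁺₁ (f ∘ suc) n λ j<i i<n fi≡fj →
    <⇒≢ j<i (sym (suc-injective (injective z<s i<n z<s (<-trans j<i i<n) fi≡fj)))
  ∈-range : ∀ {k} → 0 < k → k ≤ n → k ∈ applyDownFrom suc n
  ∈-range {suc k} _ k<n = ∈-applyDownFrom⁺ suc k<n
  image⊆ : applyDownFrom (f ∘ suc) n ⊆ applyDownFrom suc n
  image⊆ v∈image with i , i<n , refl ← ∈-applyDownFrom⁻ (f ∘ suc) v∈image =
    let 0<fi , fi≤n = maps-into z<s i<n in ∈-range 0<fi fi≤n
  |range|≤ : length (applyDownFrom suc n) ≤ length (applyDownFrom (f ∘ suc) n)
  |range|≤ = ≤-reflexive (trans (length-applyDownFrom suc n) (sym (length-applyDownFrom (f ∘ suc) n)))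

[1+m]!≡product[2-to-1+m] : ∀ m → suc m ! ≡ product (applyDownFrom (2 +_) m)
[1+m]!≡product[2-to-1+m] zero    = refl
[1+m]!≡product[2-to-1+m] (suc m) = cong ((2 + m) *_) ([1+m]!≡product[2-to-1+m] m)

m+o≡n⇒m≤n : ∀ {m n} o → m + o ≡ n → m ≤ n
m+o≡n⇒m≤n {m} o refl = m≤m+n m o

m+m≢1 : ∀ m → m + m ≢ 1
m+m≢1 zero    ()
m+m≢1 (suc m) eq with () ← trans (sym (+-suc m m)) (suc-injective eq)

even∨odd : ∀ n → ∃ λ h → n ≡ h + h ⊎ n ≡ suc (h + h)
even∨odd zero    = 0 , inj₁ refl
even∨odd (suc n) with even∨odd n
... | h , inj₁ n≡h+h   = h , inj₂ (cong suc n≡h+h)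
... | h , inj₂ n≡1+h+h = suc h , inj₁ (cong suc (trans n≡1+h+h (sym (+-suc h h))))

∣∧<⇒≡0 : ∀ {n a} → n ∣ a → a < n → a ≡ 0
∣∧<⇒≡0 {suc n} {a} n∣a a<n = trans (sym (m<n⇒m%n≡m a<n)) (n∣m⇒m%n≡0 a (suc n) n∣a)

m%n≡r∧m/n≡q⇒m≡r+q*n : ∀ {m n r q} .{{_ : NonZero n}} → m % n ≡ r → m / n ≡ q → m ≡ r + q * n
m%n≡r∧m/n≡q⇒m≡r+q*n {m} {n} r≡ q≡ = trans (m≡m%n+[m/n]*n m n) (cong₂ (λ r q → r + q * n) r≡ q≡)

^-distribʳ-* : ∀ x y t → (x * y) ^ t ≡ x ^ t * y ^ t
^-distribʳ-* x y zero    = refl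
^-distribʳ-* x y (suc t) = trans (cong (x * y *_) (^-distribʳ-* x y t)) (*-interchange x y (x ^ t) (y ^ t))

[1+t]²≡1+t[2+t] : ∀ t → suc t * suc t ≡ 1 + t * (2 + t)
[1+t]²≡1+t[2+t] = solve-∀

[n+4]!≡ : ∀ n → (n + 4) ! ≡ (1 + n) * (2 + n) * (3 + n) * (4 + n) * n !
[n+4]!≡ n = trans (cong _! (+-comm n 4)) (reassociate n (n !))
  where
  reassociate : ∀ n X →
    (4 + n) * ((3 + n) * ((2 + n) * ((1 + n) * X))) ≡ (1 + n) * (2 + n) * (3 + n) * (4 + n) * X
  reassociate = solve-∀

four-consecutive+1≡square : ∀ n →
  (1 + n) * (2 + n) * (3 + n) * (4 + n) + 1 ≡ (n * n + 5 * n + 5) * (n * n + 5 * n + 5)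
four-consecutive+1≡square = solve-∀

[2n+5]²≡4[n²+5n+5]+5 : ∀ n → (2 * n + 5) * (2 * n + 5) ≡ 4 * (n * n + 5 * n + 5) + 5
[2n+5]²≡4[n²+5n+5]+5 = solve-∀

infix 4 _≡_[mod_]
_≡_[mod_] : ℕ → ℕ → (n : ℕ) → .{{NonZero n}} → Set
a ≡ b [mod n ] = a % n ≡ b % n

[n∸1]²≡1 : ∀ n .{{_ : NonZero n}} → (n ∸ 1) * (n ∸ 1) ≡ 1 [mod n ]
[n∸1]²≡1 (suc zero)    = refl
[n∸1]²≡1 (suc (suc k)) = trans (cong (_% (2 + k)) ([1+t]²≡1+t[2+t] k)) ([m+kn]%n≡m%n 1 k (2 + k))

n∸r≡[n∸1]*r : ∀ {n r} .{{_ : NonZero n}} → 0 < r → r ≤ n → n ∸ r ≡ (n ∸ 1) * r [mod n ]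
n∸r≡[n∸1]*r {suc m} {suc t} _ 1+t≤1+m = sym (trans (cong (_% suc m) m*[1+t]≡) ([m+kn]%n≡m%n (m ∸ t) t (suc m)))
  where
  open ≡-Reasoning
  t≤m : t ≤ m
  t≤m = s≤s⁻¹ 1+t≤1+m
  m*[1+t]≡ : m * suc t ≡ (m ∸ t) + t * suc m
  m*[1+t]≡ = begin
    m * suc t                ≡⟨ *-suc m t ⟩
    m + m * t                ≡⟨ cong₂ _+_ (m∸n+n≡m t≤m) (*-comm t m) ⟨
    (m ∸ t + t) + t * m      ≡⟨ +-assoc (m ∸ t) t (t * m) ⟩
    (m ∸ t) + (t + t * m)    ≡⟨ cong (m ∸ t +_) (*-suc t m) ⟨
    (m ∸ t) + t * suc m      ∎

module ModularArithmetic (n : ℕ) .{{_ : NonZero n}} where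

  +-cong-mod : ∀ {a b c d} → a ≡ b [mod n ] → c ≡ d [mod n ] → a + c ≡ b + d [mod n ]
  +-cong-mod {a} {b} {c} {d} a≡b c≡d = begin
    (a + c) % n              ≡⟨ %-distribˡ-+ a c n ⟩
    (a % n + c % n) % n      ≡⟨ cong₂ (λ u v → (u + v) % n) a≡b c≡d ⟩
    (b % n + d % n) % n      ≡⟨ %-distribˡ-+ b d n ⟨
    (b + d) % n              ∎
    where open ≡-Reasoning

  *-cong-mod : ∀ {a b c d} → a ≡ b [mod n ] → c ≡ d [mod n ] → a * c ≡ b * d [mod n ]
  *-cong-mod {a} {b} {c} {d} a≡b c≡d = begin
    (a * c) % n              ≡⟨ %-distribˡ-* a c n ⟩
    (a % n * (c % n)) % n    ≡⟨ cong₂ (λ u v → (u * v) % n) a≡b c≡d ⟩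
    (b % n * (d % n)) % n    ≡⟨ %-distribˡ-* b d n ⟨
    (b * d) % n              ∎
    where open ≡-Reasoning

  ^-cong-mod : ∀ {a b} k → a ≡ b [mod n ] → a ^ k ≡ b ^ k [mod n ]
  ^-cong-mod zero    _   = refl
  ^-cong-mod (suc k) a≡b = *-cong-mod a≡b (^-cong-mod k a≡b)

  ∏-cong-mod : ∀ m {f g} → (∀ {k} → 0 < k → k ≤ m → f k ≡ g k [mod n ]) → ∏ m f ≡ ∏ m g [mod n ]
  ∏-cong-mod zero    _   = refl
  ∏-cong-mod (suc m) f≡g =
    *-cong-mod (f≡g z<s ≤-refl) (∏-cong-mod m (λ 0<k k≤m → f≡g 0<k (m≤n⇒m≤1+n k≤m)))

  ∣⇒≡0-mod : ∀ {a} → n ∣ a → a ≡ 0 [mod n ]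
  ∣⇒≡0-mod {a} n∣a = trans (n∣m⇒m%n≡0 a n n∣a) (sym (m*n%n≡0 0 n))

  ≡0-mod⇒∣ : ∀ {a} → a ≡ 0 [mod n ] → n ∣ a
  ≡0-mod⇒∣ {a} a≡0 = m%n≡0⇒n∣m a n (trans a≡0 (m*n%n≡0 0 n))

  ≡-mod⇒∣∸ : ∀ {a b} → a ≡ b [mod n ] → n ∣ a ∸ b
  ≡-mod⇒∣∸ {a} {b} a≡b = divides (a / n ∸ b / n) (begin
    a ∸ b                                       ≡⟨ cong₂ _∸_ (m≡m%n+[m/n]*n a n) (m≡m%n+[m/n]*n b n) ⟩
    (a % n + a / n * n) ∸ (b % n + b / n * n)   ≡⟨ cong (λ r → (r + a / n * n) ∸ (b % n + b / n * n)) a≡b ⟩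
    (b % n + a / n * n) ∸ (b % n + b / n * n)   ≡⟨ [m+n]∸[m+o]≡n∸o (b % n) _ _ ⟩
    a / n * n ∸ b / n * n                       ≡⟨ *-distribʳ-∸ n (a / n) (b / n) ⟨
    (a / n ∸ b / n) * n                         ∎)
    where open ≡-Reasoning

  ∣∸⇒≡-mod : ∀ {a b} → b ≤ a → n ∣ a ∸ b → a ≡ b [mod n ]
  ∣∸⇒≡-mod {a} {b} b≤a n∣a∸b = begin
    a % n              ≡⟨ cong (_% n) (m+[n∸m]≡n b≤a) ⟨
    (b + (a ∸ b)) % n  ≡⟨ %-remove-+ʳ b n∣a∸b ⟩
    b % n              ∎
    where open ≡-Reasoning

  ≡-mod⇒≡ : ∀ {a b} → a ≡ b [mod n ] → a < n → b < n → a ≡ b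
  ≡-mod⇒≡ {a} {b} a≡b a<n b<n = trans (sym (m<n⇒m%n≡m a<n)) (trans a≡b (m<n⇒m%n≡m b<n))

  x²≡1⇒x^[t+t]≡1 : ∀ {x} t → x * x ≡ 1 [mod n ] → x ^ (t + t) ≡ 1 [mod n ]
  x²≡1⇒x^[t+t]≡1 {x} t x²≡1 = begin
    x ^ (t + t) % n      ≡⟨ cong (_% n) (trans (^-distribˡ-+-* x t t) (sym (^-distribʳ-* x x t))) ⟩
    (x * x) ^ t % n      ≡⟨ ^-cong-mod t x²≡1 ⟩
    1 ^ t % n            ≡⟨ cong (_% n) (^-zeroˡ t) ⟩
    1 % n                ∎
    where open ≡-Reasoning

  module _ (ι : ℕ → ℕ) where

    InversePairs : List ℕ → Set
    InversePairs xs = ∀ {x} → x ∈ xs → ι x ∈ xs × ι x ≢ x × ι (ι x) ≡ x × (x * ι x ≡ 1 [mod n ])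

    product-inversePairs≡1 : ∀ k xs → length xs ≤ k → Unique xs → InversePairs xs → product xs ≡ 1 [mod n ]
    product-inversePairs≡1 _       []       _           _                  _     = refl
    product-inversePairs≡1 (suc k) (x ∷ xs) (s≤s |xs|≤) (x∉xs ∷ xs-unique) pairs
      with ιx∈x∷xs , ιx≢x , ιιx≡x , x*ιx≡1 ← pairs (here refl)
      with zs , xs↭ιx∷zs ← ∈⇒↭∷ (∈-∷-≢ ιx∈x∷xs ιx≢x)
      with ιx∉zs ∷ zs-unique ← Unique-resp-↭ (setoid ℕ) (↭⇒↭ₛ xs↭ιx∷zs) xs-unique = begin
        (x * product xs) % n           ≡⟨ cong (λ m → (x * m) % n) (product-↭ xs↭ιx∷zs) ⟩
        (x * (ι x * product zs)) % n   ≡⟨ cong (_% n) (*-assoc x (ι x) (product zs)) ⟨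
        (x * ι x * product zs) % n     ≡⟨ *-cong-mod x*ιx≡1 (product-inversePairs≡1 k zs |zs|≤ zs-unique zs-pairs) ⟩
        (1 * 1) % n                    ∎
      where
      open ≡-Reasoning
      zs⊆xs : zs ⊆ xs
      zs⊆xs = ∈-resp-↭ (↭-sym xs↭ιx∷zs) ∘ there
      |zs|≤ : length zs ≤ k
      |zs|≤ = ≤-trans (n≤1+n _) (subst (_≤ k) (↭-length xs↭ιx∷zs) |xs|≤)
      zs-pairs : InversePairs zs
      zs-pairs {w} w∈zs with ιw∈x∷xs , ιw≢w , ιιw≡w , w*ιw≡1 ← pairs (there (zs⊆xs w∈zs)) =
        ιw∈zs , ιw≢w , ιιw≡w , w*ιw≡1
        where
        ιw≢x : ι w ≢ x
        ιw≢x ιw≡x = All.lookup ιx∉zs w∈zs (trans (cong ι (sym ιw≡x)) ιιw≡w)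
        ιw≢ιx : ι w ≢ ι x
        ιw≢ιx ιw≡ιx =
          All.lookup x∉xs (zs⊆xs w∈zs) (trans (sym ιιx≡x) (trans (cong ι (sym ιw≡ιx)) ιιw≡w))
        ιw∈zs : ι w ∈ zs
        ιw∈zs = ∈-∷-≢ (∈-resp-↭ xs↭ιx∷zs (∈-∷-≢ ιw∈x∷xs ιw≢x)) ιw≢ιx

module PrimeModulus {p : ℕ} (p-prime : Prime p) where

  private instance _ = prime⇒nonZero p-prime
  open ModularArithmetic p

  1<p : 1 < p
  1<p = nonTrivial⇒n>1 p {{prime⇒nonTrivial p-prime}}

  1≢0-mod : ¬ 1 ≡ 0 [mod p ]
  1≢0-mod 1≡0 = <⇒≢ 1<p (sym (∣1⇒≡1 (≡0-mod⇒∣ 1≡0)))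

  ∤-small : ∀ {a} → 0 < a → a < p → ¬ p ∣ a
  ∤-small 0<a a<p = >⇒∤ {{>-nonZero 0<a}} a<p

  ∤-* : ∀ {a b} → ¬ p ∣ a → ¬ p ∣ b → ¬ p ∣ a * b
  ∤-* p∤a p∤b p∣ab = [ p∤a , p∤b ]′ (euclidsLemma _ _ p-prime p∣ab)

  ∤-! : ∀ n → n < p → ¬ p ∣ n !
  ∤-! zero    _   = ∤-small z<s 1<p
  ∤-! (suc n) n<p = ∤-* (∤-small z<s n<p) (∤-! n (<-trans (n<1+n n) n<p))

  private
    *-cancelʳ-mod-≥ : ∀ {a b c} → ¬ p ∣ c → b ≤ a → a * c ≡ b * c [mod p ] → a ≡ b [mod p ]
    *-cancelʳ-mod-≥ {a} {b} {c} p∤c b≤a ac≡bc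
      with euclidsLemma (a ∸ b) c p-prime (subst (p ∣_) (sym (*-distribʳ-∸ c a b)) (≡-mod⇒∣∸ ac≡bc))
    ... | inj₁ p∣a∸b = ∣∸⇒≡-mod b≤a p∣a∸b
    ... | inj₂ p∣c   = contradiction p∣c p∤c

  *-cancelʳ-mod : ∀ {a b c} → ¬ p ∣ c → a * c ≡ b * c [mod p ] → a ≡ b [mod p ]
  *-cancelʳ-mod {a} {b} p∤c ac≡bc with ≤-total b a
  ... | inj₁ b≤a = *-cancelʳ-mod-≥ p∤c b≤a ac≡bc
  ... | inj₂ a≤b = sym (*-cancelʳ-mod-≥ p∤c a≤b (sym ac≡bc))

  *-cancelˡ-mod : ∀ {a b c} → ¬ p ∣ c → c * a ≡ c * b [mod p ] → a ≡ b [mod p ]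
  *-cancelˡ-mod {a} {b} {c} p∤c ca≡cb = *-cancelʳ-mod p∤c (begin
    (a * c) % p  ≡⟨ cong (_% p) (*-comm a c) ⟩
    (c * a) % p  ≡⟨ ca≡cb ⟩
    (c * b) % p  ≡⟨ cong (_% p) (*-comm c b) ⟩
    (b * c) % p  ∎)
    where open ≡-Reasoning

  *≡1-mod⇒∤ : ∀ {a b} → a * b ≡ 1 [mod p ] → ¬ p ∣ a
  *≡1-mod⇒∤ {b = b} ab≡1 p∣a = 1≢0-mod (trans (sym ab≡1) (∣⇒≡0-mod (∣m⇒∣m*n b p∣a)))

  inverse-unique : ∀ {a x y} → a * x ≡ 1 [mod p ] → a * y ≡ 1 [mod p ] → x < p → y < p → x ≡ y
  inverse-unique {a} ax≡1 ay≡1 =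
    ≡-mod⇒≡ (*-cancelˡ-mod {c = a} (*≡1-mod⇒∤ ax≡1) (trans ax≡1 (sym ay≡1)))

  square≡1-mod⇒≡±1 : ∀ {x} → x * x ≡ 1 [mod p ] → x < p → x ≡ 1 ⊎ x ≡ p ∸ 1
  square≡1-mod⇒≡±1 {zero}  0≡1 _ = contradiction (sym 0≡1) 1≢0-mod
  square≡1-mod⇒≡±1 {suc t} x²≡1 x<p with euclidsLemma t (2 + t) p-prime p∣t[2+t]
    where
    p∣t[2+t] : p ∣ t * (2 + t)
    p∣t[2+t] =
      subst (p ∣_) (m+n∸m≡n 1 _) (≡-mod⇒∣∸ (trans (cong (_% p) (sym ([1+t]²≡1+t[2+t] t))) x²≡1))
  ... | inj₁ p∣t   = inj₁ (cong suc (∣∧<⇒≡0 p∣t (<-trans (n<1+n t) x<p)))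
  ... | inj₂ p∣2+t = inj₂ (cong (_∸ 1) (≤-antisym x<p (∣⇒≤ p∣2+t)))

2∣prime⇒≡2 : ∀ {p} → Prime p → 2 ∣ p → p ≡ 2
2∣prime⇒≡2 p-prime 2∣p with prime⇒irreducible p-prime 2∣p
... | inj₂ 2≡p = sym 2≡p

prime⇒≡2∨odd : ∀ {p} → Prime p → p ≡ 2 ⊎ ∃ λ h → p ≡ suc (h + h)
prime⇒≡2∨odd {p} p-prime with even∨odd p
... | h , inj₁ p≡h+h   = inj₁ (2∣prime⇒≡2 p-prime (divides h (trans p≡h+h (solve (h ∷ [])))))
... | h , inj₂ p≡1+h+h = inj₂ (h , p≡1+h+h)

module OddPrime {p : ℕ} (p-prime : Prime p) {h : ℕ} (p≡1+2h : p ≡ suc (h + h)) where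

  private instance _ = prime⇒nonZero p-prime
  open ModularArithmetic p
  open PrimeModulus p-prime

  -- Gauss's half system [1, h]: ρ r ∈ [1, h] is the representative of ±r and σ r its sign, with
  -- p ∸ 1 standing for -1, so that ρ r ≡ σ r * r; ∏σ a is Gauss's (-1)^μ.
  σ : ℕ → ℕ
  σ r with r ≤? h
  ... | yes _ = 1
  ... | no  _ = p ∸ 1

  ρ : ℕ → ℕ
  ρ r with r ≤? h
  ... | yes _ = r
  ... | no  _ = p ∸ r

  ∏σ : ℕ → ℕ
  ∏σ a = ∏ h (λ k → σ (a * k % p))

  σ-≤ : ∀ {r} → r ≤ h → σ r ≡ 1
  σ-≤ {r} r≤h with r ≤? h
  ... | yes _   = refl
  ... | no  r≰h = contradiction r≤h r≰h

  σ-> : ∀ {r} → h < r → σ r ≡ p ∸ 1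
  σ-> {r} h<r with r ≤? h
  ... | yes r≤h = contradiction r≤h (<⇒≱ h<r)
  ... | no  _   = refl

  σ*σ≡1 : ∀ r → σ r * σ r ≡ 1 [mod p ]
  σ*σ≡1 r with r ≤? h
  ... | yes _ = refl
  ... | no  _ = [n∸1]²≡1 p

  ρ≡σ* : ∀ {r} → 0 < r → r < p → ρ r ≡ σ r * r [mod p ]
  ρ≡σ* {r} 0<r r<p with r ≤? h
  ... | yes _ = cong (_% p) (sym (*-identityˡ r))
  ... | no  _ = n∸r≡[n∸1]*r 0<r (<⇒≤ r<p)

  h<p : h < p
  h<p = subst (h <_) (sym p≡1+2h) (s≤s (m≤m+n h h))

  ρ-range : ∀ {r} → 0 < r → r < p → 0 < ρ r × ρ r ≤ h
  ρ-range {r} 0<r r<p with r ≤? h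
  ... | yes r≤h = 0<r , r≤h
  ... | no  r≰h = m<n⇒0<n∸m r<p , ≤-trans (∸-monoʳ-≤ p (≰⇒> r≰h)) (≤-reflexive p∸[1+h]≡h)
    where
    p∸[1+h]≡h : p ∸ suc h ≡ h
    p∸[1+h]≡h = trans (cong (_∸ suc h) p≡1+2h) (m+n∸m≡n h h)

  ρ≡ρ⇒≡⊎+≡p : ∀ {r₁ r₂} → r₁ < p → r₂ < p → ρ r₁ ≡ ρ r₂ → r₁ ≡ r₂ ⊎ r₁ + r₂ ≡ p
  ρ≡ρ⇒≡⊎+≡p {r₁} {r₂} r₁<p r₂<p eq with r₁ ≤? h | r₂ ≤? h
  ... | yes _ | yes _ = inj₁ eq
  ... | no  _ | no  _ = inj₁ (∸-cancelˡ-≡ (<⇒≤ r₁<p) (<⇒≤ r₂<p) eq)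
  ... | yes _ | no  _ = inj₂ (trans (cong (_+ r₂) eq) (m∸n+n≡m (<⇒≤ r₂<p)))
  ... | no  _ | yes _ = inj₂ (trans (cong (r₁ +_) (sym eq)) (m+[n∸m]≡n (<⇒≤ r₁<p)))

  module _ {a : ℕ} (p∤a : ¬ p ∣ a) where

    private
      0<a*k%p : ∀ {k} → 0 < k → k ≤ h → 0 < a * k % p
      0<a*k%p {k} 0<k k≤h = n≢0⇒n>0 (∤-* p∤a (∤-small 0<k (≤-<-trans k≤h h<p)) ∘ m%n≡0⇒n∣m (a * k) p)

      ρₐ-range : ∀ {k} → 0 < k → k ≤ h → 0 < ρ (a * k % p) × ρ (a * k % p) ≤ h
      ρₐ-range {k} 0<k k≤h = ρ-range (0<a*k%p 0<k k≤h) (m%n<n (a * k) p)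

      ρₐ-injective : ∀ {j k} → 0 < j → j ≤ h → 0 < k → k ≤ h → ρ (a * j % p) ≡ ρ (a * k % p) → j ≡ k
      ρₐ-injective {j} {k} 0<j j≤h 0<k k≤h eq with ρ≡ρ⇒≡⊎+≡p (m%n<n (a * j) p) (m%n<n (a * k) p) eq
      ... | inj₁ aj≡ak   = ≡-mod⇒≡ (*-cancelˡ-mod p∤a aj≡ak) (≤-<-trans j≤h h<p) (≤-<-trans k≤h h<p)
      ... | inj₂ aj+ak≡p =
        contradiction (≡0-mod⇒∣ a[j+k]≡0) (∤-* p∤a (∤-small (≤-trans 0<j (m≤m+n j k)) j+k<p))
        where
        open ≡-Reasoning
        j+k<p : j + k < p
        j+k<p = subst (j + k <_) (sym p≡1+2h) (s≤s (+-mono-≤ j≤h k≤h))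
        a[j+k]≡0 : a * (j + k) ≡ 0 [mod p ]
        a[j+k]≡0 = begin
          a * (j + k) % p                ≡⟨ cong (_% p) (*-distribˡ-+ a j k) ⟩
          (a * j + a * k) % p            ≡⟨ +-cong-mod (m%n%n≡m%n (a * j) p) (m%n%n≡m%n (a * k) p) ⟨
          (a * j % p + a * k % p) % p    ≡⟨ cong (_% p) aj+ak≡p ⟩
          p % p                          ≡⟨ ∣⇒≡0-mod ∣-refl ⟩
          0 % p                          ∎

    gauss-lemma : ∏σ a * a ^ h ≡ 1 [mod p ]
    gauss-lemma = sym (*-cancelʳ-mod (∤-! h h<p) (begin
      (1 * h !) % p                                  ≡⟨ cong (_% p) (*-identityˡ (h !)) ⟩
      h ! % p                                        ≡⟨ cong (_% p) (∏-permutation h ρₐ ρₐ-range ρₐ-injective) ⟨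
      ∏ h ρₐ % p                                     ≡⟨ ∏-cong-mod h (λ 0<k k≤h → ρ≡σ* (0<a*k%p 0<k k≤h) (m%n<n _ p)) ⟩
      ∏ h (λ k → σₐ k * (a * k % p)) % p             ≡⟨ ∏-cong-mod h (λ {k} _ _ → *-cong-mod {σₐ k} refl (m%n%n≡m%n (a * k) p)) ⟩
      ∏ h (λ k → σₐ k * (a * k)) % p                 ≡⟨ cong (_% p) (∏-* h σₐ (a *_)) ⟩
      (∏σ a * ∏ h (a *_)) % p                        ≡⟨ cong (λ m → (∏σ a * m) % p) a^h*h! ⟩
      (∏σ a * (a ^ h * h !)) % p                     ≡⟨ cong (_% p) (*-assoc (∏σ a) (a ^ h) (h !)) ⟨
      (∏σ a * a ^ h * h !) % p                       ∎))
      where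
      open ≡-Reasoning
      ρₐ σₐ : ℕ → ℕ
      ρₐ k = ρ (a * k % p)
      σₐ k = σ (a * k % p)
      a^h*h! : ∏ h (a *_) ≡ a ^ h * h !
      a^h*h! = trans (∏-* h (λ _ → a) id) (cong₂ _*_ (∏-const h a) (∏-id h))

  ∏σ*∏σ≡1 : ∀ a → ∏σ a * ∏σ a ≡ 1 [mod p ]
  ∏σ*∏σ≡1 a = begin
    (∏σ a * ∏σ a) % p                              ≡⟨ cong (_% p) (∏-* h σₐ σₐ) ⟨
    ∏ h (λ k → σₐ k * σₐ k) % p                    ≡⟨ ∏-cong-mod h (λ {k} _ _ → σ*σ≡1 (a * k % p)) ⟩
    ∏ h (λ _ → 1) % p                              ≡⟨ cong (_% p) (trans (∏-const h 1) (^-zeroˡ h)) ⟩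
    1 % p                                          ∎
    where
    open ≡-Reasoning
    σₐ : ℕ → ℕ
    σₐ k = σ (a * k % p)

  -- Since every sign squares to 1, squaring Gauss's lemma gives Fermat's little theorem.
  fermat : ∀ {a} → ¬ p ∣ a → a ^ (h + h) ≡ 1 [mod p ]
  fermat {a} p∤a = begin
    a ^ (h + h) % p                          ≡⟨ cong (_% p) (trans (^-distribˡ-+-* a h h) (sym (*-identityˡ _))) ⟩
    (1 * (a ^ h * a ^ h)) % p                ≡⟨ *-cong-mod (∏σ*∏σ≡1 a) refl ⟨
    (∏σ a * ∏σ a * (a ^ h * a ^ h)) % p      ≡⟨ cong (_% p) (*-interchange (∏σ a) (∏σ a) (a ^ h) (a ^ h)) ⟩
    (∏σ a * a ^ h * (∏σ a * a ^ h)) % p      ≡⟨ *-cong-mod (gauss-lemma p∤a) (gauss-lemma p∤a) ⟩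
    (1 * 1) % p                              ∎
    where open ≡-Reasoning

  odd-signs⇒nonresidue : ∀ {a z} t → ¬ p ∣ a → ∏σ a ≡ (p ∸ 1) ^ suc (t + t) → ¬ z * z ≡ a [mod p ]
  odd-signs⇒nonresidue {a} {z} t p∤a ∏σa≡[p∸1]^odd z²≡a =
    m+m≢1 h (trans (sym p∸1≡h+h) (≡-mod⇒≡ p∸1≡1 p∸1<p 1<p))
    where
    open ≡-Reasoning
    p∸1≡h+h : p ∸ 1 ≡ h + h
    p∸1≡h+h = cong (_∸ 1) p≡1+2h
    p∸1<p : p ∸ 1 < p
    p∸1<p = subst (_< p) (sym p∸1≡h+h) (subst (h + h <_) (sym p≡1+2h) ≤-refl)
    p∤z : ¬ p ∣ z
    p∤z p∣z = p∤a (≡0-mod⇒∣ (trans (sym z²≡a) (∣⇒≡0-mod (∣m⇒∣m*n z p∣z))))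
    a^h≡1 : a ^ h ≡ 1 [mod p ]
    a^h≡1 = begin
      a ^ h % p          ≡⟨ ^-cong-mod h z²≡a ⟨
      (z * z) ^ h % p    ≡⟨ cong (_% p) (trans (^-distribʳ-* z z h) (sym (^-distribˡ-+-* z h h))) ⟩
      z ^ (h + h) % p    ≡⟨ fermat p∤z ⟩
      1 % p              ∎
    p∸1≡1 : p ∸ 1 ≡ 1 [mod p ]
    p∸1≡1 = begin
      (p ∸ 1) % p                     ≡⟨ cong (_% p) (*-identityʳ (p ∸ 1)) ⟨
      ((p ∸ 1) * 1) % p               ≡⟨ *-cong-mod {p ∸ 1} refl (x²≡1⇒x^[t+t]≡1 t ([n∸1]²≡1 p)) ⟨
      (p ∸ 1) ^ suc (t + t) % p       ≡⟨ cong (_% p) ∏σa≡[p∸1]^odd ⟨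
      ∏σ a % p                        ≡⟨ cong (_% p) (*-identityʳ (∏σ a)) ⟨
      (∏σ a * 1) % p                  ≡⟨ *-cong-mod {∏σ a} refl a^h≡1 ⟨
      (∏σ a * a ^ h) % p              ≡⟨ gauss-lemma p∤a ⟩
      1 % p                           ∎

  %-window : ∀ j {m} → j * p ≤ m → m < j * p + p → m % p ≡ m ∸ j * p
  %-window j {m} jp≤m m<jp+p =
    trans (sym (m*n≤o⇒[o∸m*n]%n≡o%n j jp≤m)) (m<n⇒m%n≡m (m<n+o⇒m∸n<o m (j * p) m<jp+p))

  module _ (a j b m : ℕ) where

    private
      σₐ : ℕ → ℕ
      σₐ k = σ (a * k % p)

      bounds : ∀ {i} → 0 < i → i ≤ m → a * (b + 1) ≤ a * (b + i) × a * (b + i) ≤ a * (b + m)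
      bounds 0<i i≤m = *-monoʳ-≤ a (+-monoʳ-≤ b 0<i) , *-monoʳ-≤ a (+-monoʳ-≤ b i≤m)

    ∏σ-peel⁺ : j * p ≤ a * (b + 1) → a * (b + m) ≤ j * p + h → ∏ (b + m) σₐ ≡ ∏ b σₐ
    ∏σ-peel⁺ lo hi = begin
      ∏ (b + m) σₐ                       ≡⟨ ∏-+ b m σₐ ⟩
      ∏ m (λ i → σₐ (b + i)) * ∏ b σₐ    ≡⟨ cong (_* ∏ b σₐ) (trans (∏-cong m σ≡1) (∏-const m 1)) ⟩
      1 ^ m * ∏ b σₐ                     ≡⟨ cong (_* ∏ b σₐ) (^-zeroˡ m) ⟩
      1 * ∏ b σₐ                         ≡⟨ *-identityˡ (∏ b σₐ) ⟩
      ∏ b σₐ                             ∎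
      where
      open ≡-Reasoning
      σ≡1 : ∀ {i} → 0 < i → i ≤ m → σₐ (b + i) ≡ 1
      σ≡1 {i} 0<i i≤m = trans (cong σ (%-window j (≤-trans lo l) (≤-<-trans x≤ (+-monoʳ-< (j * p) h<p))))
                              (σ-≤ (m≤n+o⇒m∸n≤o _ (j * p) x≤))
        where
        l : a * (b + 1) ≤ a * (b + i)
        l = proj₁ (bounds 0<i i≤m)
        x≤ : a * (b + i) ≤ j * p + h
        x≤ = ≤-trans (proj₂ (bounds 0<i i≤m)) hi

    ∏σ-peel⁻ : j * p + h < a * (b + 1) → a * (b + m) < j * p + p → ∏ (b + m) σₐ ≡ (p ∸ 1) ^ m * ∏ b σₐ
    ∏σ-peel⁻ lo hi =
      trans (∏-+ b m σₐ) (cong (_* ∏ b σₐ) (trans (∏-cong m σ≡p∸1) (∏-const m (p ∸ 1))))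
      where
      σ≡p∸1 : ∀ {i} → 0 < i → i ≤ m → σₐ (b + i) ≡ p ∸ 1
      σ≡p∸1 {i} 0<i i≤m =
        trans (cong σ (%-window j (≤-trans (m≤m+n (j * p) h) (<⇒≤ lo<x)) (≤-<-trans x≤ hi)))
              (σ-> (m+n≤o⇒m≤o∸n (suc h) (subst (_≤ a * (b + i)) (cong suc (+-comm (j * p) h)) lo<x)))
        where
        lo<x : j * p + h < a * (b + i)
        lo<x = <-≤-trans lo (proj₁ (bounds 0<i i≤m))
        x≤ : a * (b + i) ≤ a * (b + m)
        x≤ = proj₂ (bounds 0<i i≤m)

fermat : ∀ {p a} .{{_ : NonZero p}} → Prime p → ¬ p ∣ a → a ^ (p ∸ 1) ≡ 1 [mod p ]
fermat {a = a} p-prime p∤a with prime⇒≡2∨odd p-prime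
... | inj₁ refl       =
  trans (cong (_% 2) (*-identityʳ a)) (≤-antisym (s≤s⁻¹ (m%n<n a 2)) (n≢0⇒n>0 (p∤a ∘ m%n≡0⇒n∣m a 2)))
... | inj₂ (h , refl) = OddPrime.fermat p-prime {h} refl p∤a

module Wilson {p m : ℕ} (p-prime : Prime p) (p≡3+m : p ≡ 3 + m) where

  private instance _ = prime⇒nonZero p-prime
  open ModularArithmetic p
  open PrimeModulus p-prime
  open ≡-Reasoning

  -- ι x = x^(p-2) inverts x by Fermat, and the list [2, p - 2] consists exactly of the units that
  -- are not square roots of 1; so ι pairs its elements off.
  private
    rs : List ℕ
    rs = applyDownFrom (2 +_) m

    ι : ℕ → ℕ
    ι x = x ^ suc m % p

    p∸1≡2+m : p ∸ 1 ≡ 2 + m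
    p∸1≡2+m = cong (_∸ 1) p≡3+m

    ≤2+m⇒<p : ∀ {x} → x ≤ 2 + m → x < p
    ≤2+m⇒<p {x} x≤2+m = subst (x <_) (sym p≡3+m) (s≤s x≤2+m)

    rs-unique : Unique rs
    rs-unique = applyDownFrom⁺₁ (2 +_) m λ j<i _ 2+i≡2+j →
      <⇒≢ j<i (sym (suc-injective (suc-injective 2+i≡2+j)))

    ∈rs⇒ : ∀ {x} → x ∈ rs → 0 < x × x < p × ¬ x * x ≡ 1 [mod p ]
    ∈rs⇒ x∈rs with i , i<m , refl ← ∈-applyDownFrom⁻ (2 +_) x∈rs = z<s , ≤2+m⇒<p 2+i≤2+m , x²≢1
      where
      2+i≤2+m : 2 + i ≤ 2 + m
      2+i≤2+m = s≤s (s≤s (<⇒≤ i<m))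
      x²≢1 : ¬ (2 + i) * (2 + i) ≡ 1 [mod p ]
      x²≢1 x²≡1 with square≡1-mod⇒≡±1 x²≡1 (≤2+m⇒<p 2+i≤2+m)
      ... | inj₂ 2+i≡p∸1 = <⇒≢ i<m (suc-injective (suc-injective (trans 2+i≡p∸1 p∸1≡2+m)))

    ⇒∈rs : ∀ {x} → 0 < x → x < p → ¬ x * x ≡ 1 [mod p ] → x ∈ rs
    ⇒∈rs {suc zero}    _ _   x²≢1 = contradiction refl x²≢1
    ⇒∈rs {suc (suc i)} _ x<p x²≢1 =
      ∈-applyDownFrom⁺ (2 +_) (s≤s⁻¹ (s≤s⁻¹ (≤∧≢⇒< (s≤s⁻¹ (subst (2 + i <_) p≡3+m x<p)) x≢p∸1)))
      where
      x≢p∸1 : 2 + i ≢ 2 + m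
      x≢p∸1 x≡2+m = x²≢1 (subst (λ y → y * y ≡ 1 [mod p ]) (trans p∸1≡2+m (sym x≡2+m)) ([n∸1]²≡1 p))

    x*ιx≡1 : ∀ {x} → ¬ p ∣ x → x * ι x ≡ 1 [mod p ]
    x*ιx≡1 {x} p∤x = begin
      (x * ι x) % p        ≡⟨ *-cong-mod {x} refl (m%n%n≡m%n (x ^ suc m) p) ⟩
      x ^ (2 + m) % p      ≡⟨ cong (λ k → x ^ k % p) p∸1≡2+m ⟨
      x ^ (p ∸ 1) % p      ≡⟨ fermat p-prime p∤x ⟩
      1 % p                ∎

    ι-pairs : InversePairs ι rs
    ι-pairs {x} x∈rs with 0<x , x<p , x²≢1 ← ∈rs⇒ x∈rs =
      ⇒∈rs 0<ιx ιx<p ιx²≢1 , ιx≢x , ιιx≡x , x*ιx≡1 p∤x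
      where
      p∤x : ¬ p ∣ x
      p∤x = ∤-small 0<x x<p
      ιx<p : ι x < p
      ιx<p = m%n<n _ p
      ιx*x≡1 : ι x * x ≡ 1 [mod p ]
      ιx*x≡1 = trans (cong (_% p) (*-comm (ι x) x)) (x*ιx≡1 p∤x)
      p∤ιx : ¬ p ∣ ι x
      p∤ιx = *≡1-mod⇒∤ ιx*x≡1
      0<ιx : 0 < ι x
      0<ιx = n≢0⇒n>0 λ ιx≡0 → p∤ιx (subst (p ∣_) (sym ιx≡0) (p ∣0))
      ιx≢x : ι x ≢ x
      ιx≢x ιx≡x = x²≢1 (subst (λ y → x * y ≡ 1 [mod p ]) ιx≡x (x*ιx≡1 p∤x))
      ιιx≡x : ι (ι x) ≡ x
      ιιx≡x = inverse-unique {ι x} (x*ιx≡1 p∤ιx) ιx*x≡1 (m%n<n _ p) x<p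
      ιx²≢1 : ¬ ι x * ι x ≡ 1 [mod p ]
      ιx²≢1 ιx²≡1 = ιx≢x (inverse-unique {ι x} ιx²≡1 ιx*x≡1 ιx<p x<p)

  p∣[p∸1]!+1 : p ∣ (p ∸ 1) ! + 1
  p∣[p∸1]!+1 = ≡0-mod⇒∣ (begin
    ((p ∸ 1) ! + 1) % p            ≡⟨ +-cong-mod {(p ∸ 1) !} [p∸1]!≡p∸1 refl ⟩
    (p ∸ 1 + 1) % p                ≡⟨ cong (_% p) (m∸n+n≡m (<⇒≤ 1<p)) ⟩
    p % p                          ≡⟨ ∣⇒≡0-mod ∣-refl ⟩
    0 % p                          ∎)
    where
    [1+m]!≡1 : suc m ! ≡ 1 [mod p ]
    [1+m]!≡1 = trans (cong (_% p) ([1+m]!≡product[2-to-1+m] m))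
      (product-inversePairs≡1 ι m rs (≤-reflexive (length-applyDownFrom (2 +_) m)) rs-unique ι-pairs)
    [p∸1]!≡p∸1 : (p ∸ 1) ! ≡ p ∸ 1 [mod p ]
    [p∸1]!≡p∸1 = begin
      (p ∸ 1) ! % p                  ≡⟨ cong (λ k → k ! % p) p∸1≡2+m ⟩
      ((2 + m) * suc m !) % p        ≡⟨ *-cong-mod {2 + m} refl [1+m]!≡1 ⟩
      ((2 + m) * 1) % p              ≡⟨ cong (_% p) (trans (*-identityʳ (2 + m)) (sym p∸1≡2+m)) ⟩
      (p ∸ 1) % p                    ∎

wilson : ∀ {p} → Prime p → p ∣ (p ∸ 1) ! + 1
wilson {zero}              p-prime = contradiction (PrimeModulus.1<p p-prime) λ ()
wilson {suc zero}          p-prime = contradiction (PrimeModulus.1<p p-prime) (<-irrefl refl)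
wilson {suc (suc zero)}    _       = ∣-refl
wilson {suc (suc (suc m))} p-prime = Wilson.p∣[p∸1]!+1 p-prime refl

≡±2-mod-5⇒∤5 : ∀ {p} → p % 5 ≡ 2 ⊎ p % 5 ≡ 3 → ¬ p ∣ 5
≡±2-mod-5⇒∤5 p≡±2 p∣5 with prime⇒irreducible (toWitness {a? = prime? 5} _) p∣5 | p≡±2
... | inj₁ refl | inj₁ ()
... | inj₁ refl | inj₂ ()
... | inj₂ refl | inj₁ ()
... | inj₂ refl | inj₂ ()

≡±2-mod-5⇒≡3∨7-mod-10 : ∀ {p} → Prime p → p ≢ 2 → p % 5 ≡ 2 ⊎ p % 5 ≡ 3 →
                         ∃ λ s → p ≡ 3 + 10 * s ⊎ p ≡ 7 + 10 * s
≡±2-mod-5⇒≡3∨7-mod-10 {p} p-prime p≢2 p≡±2 with even∨odd (p / 5) | p≡±2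
... | s , inj₁ q≡2s   | inj₁ r≡2 =
  contradiction (2∣prime⇒≡2 p-prime (divides (1 + 5 * s)
    (trans (m%n≡r∧m/n≡q⇒m≡r+q*n r≡2 q≡2s) (solve (s ∷ []))))) p≢2
... | s , inj₂ q≡2s+1 | inj₁ r≡2 =
  s , inj₂ (trans (m%n≡r∧m/n≡q⇒m≡r+q*n r≡2 q≡2s+1) (solve (s ∷ [])))
... | s , inj₁ q≡2s   | inj₂ r≡3 =
  s , inj₁ (trans (m%n≡r∧m/n≡q⇒m≡r+q*n r≡3 q≡2s) (solve (s ∷ [])))
... | s , inj₂ q≡2s+1 | inj₂ r≡3 =
  contradiction (2∣prime⇒≡2 p-prime (divides (4 + 5 * s)
    (trans (m%n≡r∧m/n≡q⇒m≡r+q*n r≡3 q≡2s+1) (solve (s ∷ []))))) p≢2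

-- The blocks below are the k ≤ h with 5k in [0, h], (h, p), [p, p + h], (p + h, 2p) and [2p, 2p + h]
-- respectively, of sizes s, s, s, s + 1, s for p = 10s + 3 and s, s + 1, s + 1, s, s + 1 for
-- p = 10s + 7; in both cases 2s + 1 signs are -1.
five-nonresidue-3+10s : ∀ s {z} → Prime (3 + 10 * s) → ¬ (3 + 10 * s) ∣ 5 → ¬ z * z ≡ 5 [mod 3 + 10 * s ]
five-nonresidue-3+10s s {z} p-prime p∤5 = odd-signs⇒nonresidue {z = z} s p∤5 (begin
  ∏ (1 + 5 * s) σ₅
    ≡⟨ cong (λ n → ∏ n σ₅) h≡blocks ⟩
  ∏ (s + s + s + suc s + s) σ₅
    ≡⟨ ∏σ-peel⁺ 5 2 (s + s + s + suc s) s
         (m+o≡n⇒m≤n 4 (solve (s ∷ []))) (m+o≡n⇒m≤n 2 (solve (s ∷ []))) ⟩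
  ∏ (s + s + s + suc s) σ₅
    ≡⟨ ∏σ-peel⁻ 5 1 (s + s + s) (suc s)
         (m+o≡n⇒m≤n 0 (solve (s ∷ []))) (m+o≡n⇒m≤n 0 (solve (s ∷ []))) ⟩
  ε ^ suc s * ∏ (s + s + s) σ₅
    ≡⟨ cong (ε ^ suc s *_) (∏σ-peel⁺ 5 1 (s + s) s
         (m+o≡n⇒m≤n 2 (solve (s ∷ []))) (m+o≡n⇒m≤n 4 (solve (s ∷ [])))) ⟩
  ε ^ suc s * ∏ (s + s) σ₅
    ≡⟨ cong (ε ^ suc s *_) (∏σ-peel⁻ 5 0 s s
         (m+o≡n⇒m≤n 3 (solve (s ∷ []))) (m+o≡n⇒m≤n 2 (solve (s ∷ [])))) ⟩
  ε ^ suc s * (ε ^ s * ∏ s σ₅)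
    ≡⟨ cong (λ n → ε ^ suc s * (ε ^ s * n)) (∏σ-peel⁺ 5 0 0 s z≤n (m+o≡n⇒m≤n 1 (solve (s ∷ [])))) ⟩
  ε ^ suc s * (ε ^ s * 1)
    ≡⟨ cong (ε ^ suc s *_) (*-identityʳ (ε ^ s)) ⟩
  ε ^ suc s * ε ^ s
    ≡⟨ ^-distribˡ-+-* ε (suc s) s ⟨
  ε ^ suc (s + s)
    ∎)
  where
  p≡1+2h : 3 + 10 * s ≡ suc ((1 + 5 * s) + (1 + 5 * s))
  p≡1+2h = solve (s ∷ [])
  h≡blocks : 1 + 5 * s ≡ s + s + s + suc s + s
  h≡blocks = solve (s ∷ [])
  open OddPrime p-prime {1 + 5 * s} p≡1+2h
  open ≡-Reasoning
  ε : ℕ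
  ε = 2 + 10 * s
  σ₅ : ℕ → ℕ
  σ₅ k = σ (5 * k % (3 + 10 * s))

five-nonresidue-7+10s : ∀ s {z} → Prime (7 + 10 * s) → ¬ (7 + 10 * s) ∣ 5 → ¬ z * z ≡ 5 [mod 7 + 10 * s ]
five-nonresidue-7+10s s {z} p-prime p∤5 = odd-signs⇒nonresidue {z = z} s p∤5 (begin
  ∏ (3 + 5 * s) σ₅
    ≡⟨ cong (λ n → ∏ n σ₅) h≡blocks ⟩
  ∏ (s + suc s + suc s + s + suc s) σ₅
    ≡⟨ ∏σ-peel⁺ 5 2 (s + suc s + suc s + s) (suc s)
         (m+o≡n⇒m≤n 1 (solve (s ∷ []))) (m+o≡n⇒m≤n 2 (solve (s ∷ []))) ⟩
  ∏ (s + suc s + suc s + s) σ₅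
    ≡⟨ ∏σ-peel⁻ 5 1 (s + suc s + suc s) s
         (m+o≡n⇒m≤n 4 (solve (s ∷ []))) (m+o≡n⇒m≤n 3 (solve (s ∷ []))) ⟩
  ε ^ s * ∏ (s + suc s + suc s) σ₅
    ≡⟨ cong (ε ^ s *_) (∏σ-peel⁺ 5 1 (s + suc s) (suc s)
         (m+o≡n⇒m≤n 3 (solve (s ∷ []))) (m+o≡n⇒m≤n 0 (solve (s ∷ [])))) ⟩
  ε ^ s * ∏ (s + suc s) σ₅
    ≡⟨ cong (ε ^ s *_) (∏σ-peel⁻ 5 0 s (suc s)
         (m+o≡n⇒m≤n 1 (solve (s ∷ []))) (m+o≡n⇒m≤n 1 (solve (s ∷ [])))) ⟩
  ε ^ s * (ε ^ suc s * ∏ s σ₅)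
    ≡⟨ cong (λ n → ε ^ s * (ε ^ suc s * n)) (∏σ-peel⁺ 5 0 0 s z≤n (m+o≡n⇒m≤n 3 (solve (s ∷ [])))) ⟩
  ε ^ s * (ε ^ suc s * 1)
    ≡⟨ cong (ε ^ s *_) (*-identityʳ (ε ^ suc s)) ⟩
  ε ^ s * ε ^ suc s
    ≡⟨ ^-distribˡ-+-* ε s (suc s) ⟨
  ε ^ (s + suc s)
    ≡⟨ cong (ε ^_) (+-suc s s) ⟩
  ε ^ suc (s + s)
    ∎)
  where
  p≡1+2h : 7 + 10 * s ≡ suc ((3 + 5 * s) + (3 + 5 * s))
  p≡1+2h = solve (s ∷ [])
  h≡blocks : 3 + 5 * s ≡ s + suc s + suc s + s + suc s
  h≡blocks = solve (s ∷ [])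
  open OddPrime p-prime {3 + 5 * s} p≡1+2h
  open ≡-Reasoning
  ε : ℕ
  ε = 6 + 10 * s
  σ₅ : ℕ → ℕ
  σ₅ k = σ (5 * k % (7 + 10 * s))

five-nonresidue : ∀ {p z} .{{_ : NonZero p}} → Prime p → p ≢ 2 → p % 5 ≡ 2 ⊎ p % 5 ≡ 3 →
                  ¬ z * z ≡ 5 [mod p ]
five-nonresidue {z = z} p-prime p≢2 p≡±2 with ≡±2-mod-5⇒≡3∨7-mod-10 p-prime p≢2 p≡±2
... | s , inj₁ refl = five-nonresidue-3+10s s {z} p-prime (≡±2-mod-5⇒∤5 p≡±2)
... | s , inj₂ refl = five-nonresidue-7+10s s {z} p-prime (≡±2-mod-5⇒∤5 p≡±2)

proposition2p3 : (a : ℕ) → 0 < a → Prime (a + 1) →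
    ((a + 1) % 5 ≡ 2 ⊎ (a + 1) % 5 ≡ 3) →
    ¬ (∃₂ λ b c → 0 < b × 0 < c × a < b × c ≡ b + 4 × (a ! * b ! ≡ c !))
proposition2p3 a _ p-prime p≡±2 (b , _ , _ , _ , _ , refl , a!b!≡[b+4]!) =
  five-nonresidue {z = 2 * b + 5} p-prime p≢2 p≡±2 [2b+5]²≡5
  where
  instance _ = prime⇒nonZero p-prime
  open ModularArithmetic (a + 1)
  q : ℕ
  q = b * b + 5 * b + 5
  a!≡ : a ! ≡ (1 + b) * (2 + b) * (3 + b) * (4 + b)
  a!≡ = *-cancelʳ-≡ (a !) _ (b !) {{b !≢0}} (trans a!b!≡[b+4]! ([n+4]!≡ b))
  p≢2 : a + 1 ≢ 2
  p≢2 a+1≡2 = contradiction (m*n≡1⇒n≡1 ((1 + b) * (2 + b) * (3 + b)) (4 + b) (sym 1≡a!)) λ ()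
    where
    1≡a! : 1 ! ≡ (1 + b) * (2 + b) * (3 + b) * (4 + b)
    1≡a! = subst (λ k → k ! ≡ _) (+-cancelʳ-≡ 1 a 1 a+1≡2) a!≡
  p∣q : a + 1 ∣ q
  p∣q = [ id , id ]′ (euclidsLemma q q p-prime (subst (a + 1 ∣_) [p∸1]!+1≡q² (wilson p-prime)))
    where
    [p∸1]!+1≡q² : (a + 1 ∸ 1) ! + 1 ≡ q * q
    [p∸1]!+1≡q² = trans (cong (λ k → k ! + 1) (m+n∸n≡m a 1))
                        (trans (cong (_+ 1) a!≡) (four-consecutive+1≡square b))
  [2b+5]²≡5 : (2 * b + 5) * (2 * b + 5) ≡ 5 [mod a + 1 ]
  [2b+5]²≡5 = trans (cong (_% (a + 1)) ([2n+5]²≡4[n²+5n+5]+5 b))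
                    (+-cong-mod {4 * q} (∣⇒≡0-mod (∣n⇒∣m*n 4 p∣q)) refl)
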